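{- Let $\mathcal{D}$ be a non-trivial $2$-design with a $G$-flag-transitive group $G\le\mathrm{Aut}(\mathcal{D})$, and let $(\alpha,\beta)$ be a flag. Assume $G=G_1\times G_2$ and $G_\alpha=L_1\times L_2$ with $L_i<G_i$ for $i=1,2$. Assume further that $K=K_1\times K_2$ is a subgroup of $G_\beta$ with $K_1\le G_1$ and $K_2\le G_2$. Then $K$ is intransitive on $\mathcal{D}(\beta)$.
   Context: A $2$-design: finite point set ($v$ points), finite block set, each block incident with $k$ points, any two distinct points incident with exactly $\lambda\ge1$ blocks; non-trivial means $k<v$. A flag is an incident point-block pair; $G$-flag-transitive means $G$ is transitive on flags. $\mathcal{D}(\beta)$ is the set of points incident with the block $\beta$; $G_\alpha,G_\beta$ are stabilizers. -}

module Defs where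

open import Level using (Level; _⊔_; suc)
open import Data.Nat using (ℕ; _<_; _≤_)
open import Data.Bool using (Bool; true; _∧_)
open import Data.Fin using (Fin)
open import Data.List using (length; filterᵇ; allFin)
open import Data.Product using (Σ; _×_; ∃; ∃-syntax; _,_)
open import Relation.Binary.PropositionalEquality using (_≡_; _≢_)
open import Relation.Nullary using (¬_)
open import Algebra.Bundles using (Group)

count : ∀ {n} → (Fin n → Bool) → ℕ
count {n} p = length (filterᵇ p (allFin n))

record Is2Design (v b k lam : ℕ) (inc : Fin v → Fin b → Bool) : Set where
  field
    blockSize : ∀ (B : Fin b) → count (λ x → inc x B) ≡ k
    balanced  : ∀ (x y : Fin v) → x ≢ y → count (λ B → inc x B ∧ inc y B) ≡ lam
    lam≥1     : 1 ≤ lam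
    nontrivial : k < v

module _ {c ℓ : Level} (G : Group c ℓ) where
  open Group G

  record IsSubgroup (H : Carrier → Set (c ⊔ ℓ)) : Set (c ⊔ ℓ) where
    field
      resp  : ∀ {g h} → g ≈ h → H g → H h
      ε∈    : H ε
      ∙∈    : ∀ {g h} → H g → H h → H (g ∙ h)
      ⁻¹∈   : ∀ {g} → H g → H (g ⁻¹)

  _⊆_ : (H K : Carrier → Set (c ⊔ ℓ)) → Set (c ⊔ ℓ)
  H ⊆ K = ∀ {g} → H g → K g

  _⊂_ : (H K : Carrier → Set (c ⊔ ℓ)) → Set (c ⊔ ℓ)
  H ⊂ K = H ⊆ K × ∃[ g ] (K g × ¬ H g)

  Prod : (H₁ H₂ : Carrier → Set (c ⊔ ℓ)) → Carrier → Set (c ⊔ ℓ)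
  Prod H₁ H₂ g = ∃[ h₁ ] ∃[ h₂ ] (H₁ h₁ × H₂ h₂ × g ≈ h₁ ∙ h₂)

  record IsInternalDirectProduct (H H₁ H₂ : Carrier → Set (c ⊔ ℓ)) : Set (c ⊔ ℓ) where
    field
      sub₁   : IsSubgroup H₁
      sub₂   : IsSubgroup H₂
      H₁⊆H   : H₁ ⊆ H
      H₂⊆H   : H₂ ⊆ H
      commute : ∀ {a b} → H₁ a → H₂ b → a ∙ b ≈ b ∙ a
      trivial∩ : ∀ {g} → H₁ g → H₂ g → g ≈ ε
      generate : ∀ {g} → H g → Prod H₁ H₂ g

  Whole : Carrier → Set (c ⊔ ℓ)
  Whole _ = Level.Lift (c ⊔ ℓ) Data.Unit.⊤
    where import Data.Unit

  record IsAction {x : Level} {X : Set x} (act : Carrier → X → X) : Set (c ⊔ ℓ ⊔ x) where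
    field
      act-resp : ∀ {g h} → g ≈ h → ∀ p → act g p ≡ act h p
      act-ε    : ∀ p → act ε p ≡ p
      act-∙    : ∀ g h p → act (g ∙ h) p ≡ act g (act h p)

  record IsAutGroup {v b : ℕ} (inc : Fin v → Fin b → Bool)
                    (actP : Carrier → Fin v → Fin v)
                    (actB : Carrier → Fin b → Fin b) : Set (c ⊔ ℓ) where
    field
      actionP  : IsAction actP
      actionB  : IsAction actB
      preserve : ∀ g x B → inc x B ≡ true → inc (actP g x) (actB g B) ≡ true
      faithful : ∀ g → (∀ x → actP g x ≡ x) → (∀ B → actB g B ≡ B) → g ≈ ε

  FlagTransitive : {v b : ℕ} (inc : Fin v → Fin b → Bool)
                   (actP : Carrier → Fin v → Fin v)
                   (actB : Carrier → Fin b → Fin b) → Set c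
  FlagTransitive inc actP actB =
    ∀ x B y C → inc x B ≡ true → inc y C ≡ true →
      ∃[ g ] (actP g x ≡ y × actB g B ≡ C)

  StabP : {v : ℕ} → (Carrier → Fin v → Fin v) → Fin v → Carrier → Set (c ⊔ ℓ)
  StabP actP α g = Level.Lift (c ⊔ ℓ) (actP g α ≡ α)

  StabB : {b : ℕ} → (Carrier → Fin b → Fin b) → Fin b → Carrier → Set (c ⊔ ℓ)
  StabB actB β g = Level.Lift (c ⊔ ℓ) (actB g β ≡ β)

  TransitiveOnBlock : {v b : ℕ} (inc : Fin v → Fin b → Bool)
                      (actP : Carrier → Fin v → Fin v)
                      (H : Carrier → Set (c ⊔ ℓ)) (β : Fin b) → Set (c ⊔ ℓ)
  TransitiveOnBlock inc actP H β =
    ∀ x y → inc x β ≡ true → inc y β ≡ true → ∃[ h ] (H h × actP h x ≡ y)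

{-# OPTIONS --safe #-}
-- Write pt a₁ a₂ = a₁ a₂ α for aᵢ ∈ Gᵢ. Since G_α = L₁ × L₂ sits coordinatewise in G₁ × G₂,
-- pt a₁ a₂ determines the cosets a₁L₁ and a₂L₂, so the points (all of the form pt a₁ a₂ by
-- point-transitivity) form a grid G₁/L₁ × G₂/L₂ with at least two rows and two columns.
-- If K₁ × K₂ were transitive on D(β), each point of β would be pt k₁ k₂ with kᵢ ∈ Kᵢ, and
-- k₂ ∈ K ≤ G_β puts pt 1 k₂ on β too; moving (α, β) to any flag shows that every block is a
-- rectangle: with (a₁, a₂) and (b₁, b₂) it contains (a₁, b₂). In a 2-design that is impossible:
-- comparing the λ blocks through two pairs of points, the block through α and another point of
-- its row contains the whole column of α, then the whole row, then every point, against k < v.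

module Submission where

open import Defs
open import Level using (Level; _⊔_; lift; lower)
open import Algebra.Bundles using (Group)
import Algebra.Properties.Group
open import Data.Bool using (Bool; true; _∧_; T)
open import Data.Bool.Properties using (T-≡; ∧-conicalˡ; ∧-conicalʳ)
open import Data.Fin as Fin using (Fin)
open import Data.List using (length; filterᵇ; allFin)
open import Data.List.Properties using (filter-all; length-tabulate)
open import Data.List.Membership.Propositional using (_∈_)
open import Data.List.Membership.Propositional.Properties using (∈-filter⁺; ∈-filter⁻; ∈-allFin)
open import Data.List.Relation.Binary.Equality.Propositional using (≋⇒≡)
open import Data.List.Relation.Binary.Sublist.Propositional using (⊆-refl)
open import Data.List.Relation.Binary.Sublist.Propositional.Properties using (filter⁺; to-≋)
open import Data.List.Relation.Unary.All using (All; []; _∷_; universal)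
open import Data.List.Relation.Unary.All.Properties using (all-filter)
open import Data.Nat using (ℕ; _≤_)
open import Data.Nat.Properties using (<⇒≢)
open import Data.Product using (Σ; ∃; ∃₂; _×_; _,_; proj₁; proj₂)
open import Data.Unit using (tt)
open import Function using (_∘_; id)
open import Function.Bundles using (Equivalence)
open import Relation.Binary.PropositionalEquality as ≡
  using (_≡_; _≢_; refl; cong; cong₂; subst; module ≡-Reasoning)
open import Relation.Nullary using (¬_; yes; no)
open import Relation.Nullary.Decidable using (T?)

private
  ≡true⇒T : ∀ {x} → x ≡ true → T x
  ≡true⇒T = Equivalence.from T-≡

  T⇒≡true : ∀ {x} → T x → x ≡ true
  T⇒≡true = Equivalence.to T-≡

module _ {n : ℕ} where

  count-pos⇒∃ : (p : Fin n → Bool) → 1 ≤ count p → ∃ λ x → p x ≡ true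
  count-pos⇒∃ p = head (all-filter (T? ∘ p) (allFin n))
    where
      head : ∀ {xs} → All (T ∘ p) xs → 1 ≤ length xs → ∃ λ x → p x ≡ true
      head []       ()
      head (px ∷ _) _  = _ , T⇒≡true px

  count-all : (p : Fin n → Bool) → (∀ x → p x ≡ true) → count p ≡ n
  count-all p all-p = begin
    length (filterᵇ p (allFin n)) ≡⟨ cong length (filter-all (T? ∘ p) all-p′) ⟩
    length (allFin n)             ≡⟨ length-tabulate id ⟩
    n                             ∎
    where
      open ≡-Reasoning
      all-p′ : All (T ∘ p) (allFin n)
      all-p′ = universal (≡true⇒T ∘ all-p) (allFin n)

  count-≡∧⊆⇒⊇ : (p q : Fin n → Bool) → (∀ x → p x ≡ true → q x ≡ true) →
                count p ≡ count q → ∀ x → q x ≡ true → p x ≡ true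
  count-≡∧⊆⇒⊇ p q p⊆q count≡ x qx =
    T⇒≡true (proj₂ (∈-filter⁻ (T? ∘ p) {xs = allFin n} (subst (x ∈_) (≡.sym filters≡) x∈filter-q)))
    where
      x∈filter-q : x ∈ filterᵇ q (allFin n)
      x∈filter-q = ∈-filter⁺ (T? ∘ q) (∈-allFin x) (≡true⇒T qx)

      filters≡ : filterᵇ p (allFin n) ≡ filterᵇ q (allFin n)
      filters≡ = ≋⇒≡ (to-≋ count≡
        (filter⁺ (T? ∘ p) (T? ∘ q) (λ { refl → ≡true⇒T ∘ p⊆q _ ∘ T⇒≡true })
                 (⊆-refl {x = allFin n})))

Rectangular : ∀ {a v b} {X Y : Set a} → (Fin v → Fin b → Bool) → (X → Y → Fin v) → Set a
Rectangular inc pt =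
  ∀ C {x y x′ y′} → inc (pt x y) C ≡ true → inc (pt x′ y′) C ≡ true → inc (pt x y′) C ≡ true

module _ {v b k lam : ℕ} {inc : Fin v → Fin b → Bool} (D : Is2Design v b k lam inc) where
  open Is2Design D

  common-block : ∀ {x y} → x ≢ y → ∃ λ C → inc x C ≡ true × inc y C ≡ true
  common-block {x} {y} x≢y =
    let C , xy∈C = count-pos⇒∃ (λ C → inc x C ∧ inc y C)
                                (subst (1 ≤_) (≡.sym (balanced x y x≢y)) lam≥1)
    in C , ∧-conicalˡ _ _ xy∈C , ∧-conicalʳ _ _ xy∈C

  -- The pencil of {y, z} lies in that of {x, y}; both consist of λ blocks, so they coincide.
  pencil-transfer : ∀ {x y z} → x ≢ y → y ≢ z →
                    (∀ C → inc y C ≡ true → inc z C ≡ true → inc x C ≡ true) →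
                    ∀ C → inc x C ≡ true → inc y C ≡ true → inc z C ≡ true
  pencil-transfer {x} {y} {z} x≢y y≢z yz⇒x C x∈C y∈C =
    ∧-conicalʳ _ _ (count-≡∧⊆⇒⊇ (λ C → inc y C ∧ inc z C) (λ C → inc x C ∧ inc y C) yz⊆xy
      (≡.trans (balanced y z y≢z) (≡.sym (balanced x y x≢y))) C (cong₂ _∧_ x∈C y∈C))
    where
      yz⊆xy : ∀ C → inc y C ∧ inc z C ≡ true → inc x C ∧ inc y C ≡ true
      yz⊆xy C yz∈C = let y∈C = ∧-conicalˡ _ _ yz∈C
                     in cong₂ _∧_ (yz⇒x C y∈C (∧-conicalʳ _ _ yz∈C)) y∈C

  block-incomplete : ∀ C → ¬ (∀ x → inc x C ≡ true)
  block-incomplete C all∈C = <⇒≢ nontrivial (≡.trans (≡.sym (blockSize C)) (count-all _ all∈C))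

  grid-not-rectangular : ∀ {a} {X Y : Set a} (pt : X → Y → Fin v) →
                         (∀ p → ∃₂ λ x y → pt x y ≡ p) →
                         (x₀ x₁ : X) (y₀ y₁ : Y) →
                         (∀ y → pt x₁ y₀ ≢ pt x₀ y) → (∀ x → pt x₀ y₁ ≢ pt x y₀) →
                         ¬ Rectangular inc pt
  grid-not-rectangular pt pt-surjective x₀ x₁ y₀ y₁ x₁∉column y₁∉row rectangular =
    let B , o∈B , x₁∈B = common-block (x₁∉column y₀ ∘ ≡.sym)
    in block-incomplete B (complete o∈B x₁∈B)
    where
      complete : ∀ {B} → inc (pt x₀ y₀) B ≡ true → inc (pt x₁ y₀) B ≡ true → ∀ p → inc p B ≡ true
      complete {B} o∈B x₁∈B p with x , y , refl ← pt-surjective p = rectangular B (row x) (column y)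
        where
          column : ∀ y → inc (pt x₀ y) B ≡ true
          column y = pencil-transfer (x₁∉column y₀ ∘ ≡.sym) (x₁∉column y)
                       (λ C x₁∈C y∈C → rectangular C y∈C x₁∈C) B o∈B x₁∈B

          row : ∀ x → inc (pt x y₀) B ≡ true
          row x = pencil-transfer (y₁∉row x₀ ∘ ≡.sym) (y₁∉row x)
                    (λ C y₁∈C x∈C → rectangular C y₁∈C x∈C) B o∈B (column y₁)

module _ {c ℓ : Level} (G : Group c ℓ) where
  open Group G
  open import Algebra.Properties.Group G using (\\-leftDividesˡ; \\-leftDividesʳ; x≈z//y; ∙-cancelˡ)
  open import Relation.Binary.Reasoning.Setoid setoid

  factorisation-unique : ∀ {H H₁ H₂} → IsInternalDirectProduct G H H₁ H₂ →
                         ∀ {x₁ x₂ y₁ y₂} → H₁ x₁ → H₂ x₂ → H₁ y₁ → H₂ y₂ →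
                         x₁ ∙ x₂ ≈ y₁ ∙ y₂ → x₁ ≈ y₁ × x₂ ≈ y₂
  factorisation-unique P {x₁} {x₂} {y₁} {y₂} x₁∈H₁ x₂∈H₂ y₁∈H₁ y₂∈H₂ eq =
    x₁≈y₁ , ∙-cancelˡ y₁ x₂ y₂ (trans (∙-congʳ (sym x₁≈y₁)) eq)
    where
      open IsInternalDirectProduct P
      module H₁ = IsSubgroup sub₁
      module H₂ = IsSubgroup sub₂

      quotients≈ : y₁ \\ x₁ ≈ y₂ // x₂
      quotients≈ = x≈z//y _ _ _ (begin
        (y₁ \\ x₁) ∙ x₂  ≈⟨ assoc _ _ _ ⟩
        y₁ \\ (x₁ ∙ x₂)  ≈⟨ ∙-congˡ eq ⟩
        y₁ \\ (y₁ ∙ y₂)  ≈⟨ \\-leftDividesʳ y₁ y₂ ⟩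
        y₂               ∎)

      quotient≈ε : y₁ \\ x₁ ≈ ε
      quotient≈ε = trivial∩ (H₁.∙∈ (H₁.⁻¹∈ y₁∈H₁) x₁∈H₁)
                            (H₂.resp (sym quotients≈) (H₂.∙∈ y₂∈H₂ (H₂.⁻¹∈ x₂∈H₂)))

      x₁≈y₁ : x₁ ≈ y₁
      x₁≈y₁ = begin
        x₁               ≈⟨ \\-leftDividesˡ y₁ x₁ ⟨
        y₁ ∙ (y₁ \\ x₁)  ≈⟨ ∙-congˡ quotient≈ε ⟩
        y₁ ∙ ε           ≈⟨ identityʳ y₁ ⟩
        y₁               ∎

  subproduct-factors : ∀ {H′ G₁ G₂ H L₁ L₂} →
                       IsInternalDirectProduct G H′ G₁ G₂ → IsInternalDirectProduct G H L₁ L₂ →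
                       _⊆_ G L₁ G₁ → _⊆_ G L₂ G₂ →
                       ∀ {g x₁ x₂} → G₁ x₁ → G₂ x₂ → H g → g ≈ x₁ ∙ x₂ → L₁ x₁ × L₂ x₂
  subproduct-factors W S L₁⊆G₁ L₂⊆G₂ x₁∈G₁ x₂∈G₂ g∈H g≈x₁x₂
    with l₁ , l₂ , l₁∈L₁ , l₂∈L₂ , g≈l₁l₂ ← IsInternalDirectProduct.generate S g∈H =
    let x₁≈l₁ , x₂≈l₂ = factorisation-unique W x₁∈G₁ x₂∈G₂ (L₁⊆G₁ l₁∈L₁) (L₂⊆G₂ l₂∈L₂)
                                             (trans (sym g≈x₁x₂) g≈l₁l₂)
    in IsSubgroup.resp sub₁ (sym x₁≈l₁) l₁∈L₁ , IsSubgroup.resp sub₂ (sym x₂≈l₂) l₂∈L₂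
    where open IsInternalDirectProduct S using (sub₁; sub₂)

module _ {c ℓ : Level} (G : Group c ℓ) {x : Level} {X : Set x} {act : Group.Carrier G → X → X}
         (action : IsAction G act) where
  open Group G using (_∙_; _≈_; _⁻¹; _\\_; ε; inverseˡ; inverseʳ)
  open import Algebra.Properties.Group G using (\\-leftDividesˡ)
  open IsAction action
  open ≡-Reasoning

  act-inverseˡ : ∀ g p → act (g ⁻¹) (act g p) ≡ p
  act-inverseˡ g p = begin
    act (g ⁻¹) (act g p)  ≡⟨ act-∙ (g ⁻¹) g p ⟨
    act (g ⁻¹ ∙ g) p      ≡⟨ act-resp (inverseˡ g) p ⟩
    act ε p               ≡⟨ act-ε p ⟩
    p                     ∎

  act-inverseʳ : ∀ g p → act g (act (g ⁻¹) p) ≡ p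
  act-inverseʳ g p = begin
    act g (act (g ⁻¹) p)  ≡⟨ act-∙ g (g ⁻¹) p ⟨
    act (g ∙ g ⁻¹) p      ≡⟨ act-resp (inverseʳ g) p ⟩
    act ε p               ≡⟨ act-ε p ⟩
    p                     ∎

  act-commute : ∀ {g h} → g ∙ h ≈ h ∙ g → ∀ p → act g (act h p) ≡ act h (act g p)
  act-commute {g} {h} gh≈hg p = begin
    act g (act h p)  ≡⟨ act-∙ g h p ⟨
    act (g ∙ h) p    ≡⟨ act-resp gh≈hg p ⟩
    act (h ∙ g) p    ≡⟨ act-∙ h g p ⟩
    act h (act g p)  ∎

  \\-fixes⇒act-≡ : ∀ {g h p} → act (g \\ h) p ≡ p → act h p ≡ act g p
  \\-fixes⇒act-≡ {g} {h} {p} g\\h-fixes = begin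
    act h p                 ≡⟨ act-resp (\\-leftDividesˡ g h) p ⟨
    act (g ∙ (g \\ h)) p    ≡⟨ act-∙ g (g \\ h) p ⟩
    act g (act (g \\ h) p)  ≡⟨ cong (act g) g\\h-fixes ⟩
    act g p                 ∎

module _ {c ℓ : Level} (G : Group c ℓ) {v b : ℕ} {inc : Fin v → Fin b → Bool}
         {actP : Group.Carrier G → Fin v → Fin v} {actB : Group.Carrier G → Fin b → Fin b} where
  open Group G using (_⁻¹; ε)

  incident-pullback : IsAutGroup G inc actP actB →
                      ∀ g {p C} → inc p (actB g C) ≡ true → inc (actP (g ⁻¹) p) C ≡ true
  incident-pullback aut g {p} {C} p∈gC =
    subst (λ C′ → inc (actP (g ⁻¹) p) C′ ≡ true) (act-inverseˡ G actionB g C)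
          (preserve (g ⁻¹) p _ p∈gC)
    where open IsAutGroup aut

  flagTransitive⇒pointTransitive : ∀ {k lam} → Is2Design v b k lam inc → IsAction G actP →
                                   FlagTransitive G inc actP actB →
                                   ∀ {α β} → inc α β ≡ true → ∀ p → ∃ λ g → actP g α ≡ p
  flagTransitive⇒pointTransitive D actionP ft {α} {β} α∈β p with p Fin.≟ α
  ... | yes refl = ε , IsAction.act-ε actionP α
  ... | no p≢α =
    let C , _ , p∈C = common-block D (p≢α ∘ ≡.sym)
        g , gα≡p , _ = ft α β p C α∈β p∈C
    in g , gα≡p

module OrbitGrid {c ℓ : Level} (G : Group c ℓ) {v : ℕ} {act : Group.Carrier G → Fin v → Fin v}
                 (action : IsAction G act) (α : Fin v) {G₁ G₂ L₁ L₂ : Group.Carrier G → Set (c ⊔ ℓ)}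
                 (W : IsInternalDirectProduct G (Whole G) G₁ G₂)
                 (S : IsInternalDirectProduct G (StabP G act α) L₁ L₂)
                 (L₁⊆G₁ : _⊆_ G L₁ G₁) (L₂⊆G₂ : _⊆_ G L₂ G₂) where
  open Group G using (Carrier; _∙_; _⁻¹; _\\_; ε) renaming (refl to ≈-refl)
  open import Algebra.Properties.Loop (Algebra.Properties.Group.loop G) using (ε\\x≈x)
  open IsAction action
  open IsInternalDirectProduct W using (commute; generate)
  open IsInternalDirectProduct S using (H₁⊆H; H₂⊆H)
  module G₁ = IsSubgroup (IsInternalDirectProduct.sub₁ W)
  module G₂ = IsSubgroup (IsInternalDirectProduct.sub₂ W)
  module L₁ = IsSubgroup (IsInternalDirectProduct.sub₁ S)
  module L₂ = IsSubgroup (IsInternalDirectProduct.sub₂ S)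
  open ≡-Reasoning

  infixr 5 _▸_
  _▸_ : Carrier → Fin v → Fin v
  _▸_ = act

  pt : Carrier → Carrier → Fin v
  pt a₁ a₂ = a₁ ▸ a₂ ▸ α

  pt-ε-ε : pt ε ε ≡ α
  pt-ε-ε = ≡.trans (act-ε _) (act-ε α)

  ▸-commute : ∀ {a₁ a₂} → G₁ a₁ → G₂ a₂ → ∀ p → a₁ ▸ a₂ ▸ p ≡ a₂ ▸ a₁ ▸ p
  ▸-commute a₁∈G₁ a₂∈G₂ = act-commute G action (commute a₁∈G₁ a₂∈G₂)

  pt-translate : ∀ {h₂ k₁} → G₂ h₂ → G₁ k₁ →
                 ∀ h₁ k₂ → (h₁ ∙ h₂) ▸ pt k₁ k₂ ≡ pt (h₁ ∙ k₁) (h₂ ∙ k₂)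
  pt-translate {h₂} {k₁} h₂∈G₂ k₁∈G₁ h₁ k₂ = begin
    (h₁ ∙ h₂) ▸ k₁ ▸ k₂ ▸ α    ≡⟨ act-∙ h₁ h₂ _ ⟩
    h₁ ▸ h₂ ▸ k₁ ▸ k₂ ▸ α      ≡⟨ cong (h₁ ▸_) (▸-commute k₁∈G₁ h₂∈G₂ _) ⟨
    h₁ ▸ k₁ ▸ h₂ ▸ k₂ ▸ α      ≡⟨ act-∙ h₁ k₁ _ ⟨
    (h₁ ∙ k₁) ▸ h₂ ▸ k₂ ▸ α    ≡⟨ cong ((h₁ ∙ k₁) ▸_) (act-∙ h₂ k₂ α) ⟨
    (h₁ ∙ k₁) ▸ (h₂ ∙ k₂) ▸ α  ∎

  pt-≡⇒quotients∈L : ∀ {a₁ a₂ b₁ b₂} → G₁ a₁ → G₂ a₂ → G₁ b₁ → G₂ b₂ →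
                     pt a₁ a₂ ≡ pt b₁ b₂ → L₁ (b₁ \\ a₁) × L₂ (b₂ \\ a₂)
  pt-≡⇒quotients∈L {a₁} {a₂} {b₁} {b₂} a₁∈G₁ a₂∈G₂ b₁∈G₁ b₂∈G₂ a≡b =
    subproduct-factors G W S L₁⊆G₁ L₂⊆G₂ (G₁.∙∈ (G₁.⁻¹∈ b₁∈G₁) a₁∈G₁) (G₂.∙∈ b₂⁻¹∈G₂ a₂∈G₂)
                       (lift fixes-α) ≈-refl
    where
      b₂⁻¹∈G₂ : G₂ (b₂ ⁻¹)
      b₂⁻¹∈G₂ = G₂.⁻¹∈ b₂∈G₂

      fixes-α : ((b₁ \\ a₁) ∙ (b₂ \\ a₂)) ▸ α ≡ α
      fixes-α = begin
        ((b₁ \\ a₁) ∙ (b₂ \\ a₂)) ▸ α  ≡⟨ act-∙ _ _ α ⟩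
        pt (b₁ \\ a₁) (b₂ \\ a₂)       ≡⟨ pt-translate b₂⁻¹∈G₂ a₁∈G₁ (b₁ ⁻¹) a₂ ⟨
        (b₁ ⁻¹ ∙ b₂ ⁻¹) ▸ pt a₁ a₂     ≡⟨ cong ((b₁ ⁻¹ ∙ b₂ ⁻¹) ▸_) a≡b ⟩
        (b₁ ⁻¹ ∙ b₂ ⁻¹) ▸ pt b₁ b₂     ≡⟨ act-∙ _ _ _ ⟩
        b₁ ⁻¹ ▸ b₂ ⁻¹ ▸ b₁ ▸ b₂ ▸ α    ≡⟨ cong (b₁ ⁻¹ ▸_) (▸-commute b₁∈G₁ b₂⁻¹∈G₂ _) ⟨
        b₁ ⁻¹ ▸ b₁ ▸ b₂ ⁻¹ ▸ b₂ ▸ α    ≡⟨ act-inverseˡ G action b₁ _ ⟩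
        b₂ ⁻¹ ▸ b₂ ▸ α                 ≡⟨ act-inverseˡ G action b₂ α ⟩
        α                              ∎

  pt-≡⇒coordinates-≡ : ∀ {a₁ a₂ b₁ b₂} → G₁ a₁ → G₂ a₂ → G₁ b₁ → G₂ b₂ →
                       pt a₁ a₂ ≡ pt b₁ b₂ → a₁ ▸ α ≡ b₁ ▸ α × a₂ ▸ α ≡ b₂ ▸ α
  pt-≡⇒coordinates-≡ a₁∈G₁ a₂∈G₂ b₁∈G₁ b₂∈G₂ a≡b =
    let l₁ , l₂ = pt-≡⇒quotients∈L a₁∈G₁ a₂∈G₂ b₁∈G₁ b₂∈G₂ a≡b
    in \\-fixes⇒act-≡ G action (lower (H₁⊆H l₁)) , \\-fixes⇒act-≡ G action (lower (H₂⊆H l₂))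

  coordinates-≡⇒pt-≡ : ∀ {a₁ a₂ b₁ b₂} → G₁ a₁ → G₁ b₁ → G₂ b₂ →
                       a₁ ▸ α ≡ b₁ ▸ α → a₂ ▸ α ≡ b₂ ▸ α → pt a₁ a₂ ≡ pt b₁ b₂
  coordinates-≡⇒pt-≡ {a₁} {a₂} {b₁} {b₂} a₁∈G₁ b₁∈G₁ b₂∈G₂ a₁α≡b₁α a₂α≡b₂α = begin
    a₁ ▸ a₂ ▸ α  ≡⟨ cong (a₁ ▸_) a₂α≡b₂α ⟩
    a₁ ▸ b₂ ▸ α  ≡⟨ ▸-commute a₁∈G₁ b₂∈G₂ α ⟩
    b₂ ▸ a₁ ▸ α  ≡⟨ cong (b₂ ▸_) a₁α≡b₁α ⟩
    b₂ ▸ b₁ ▸ α  ≡⟨ ▸-commute b₁∈G₁ b₂∈G₂ α ⟨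
    b₁ ▸ b₂ ▸ α  ∎

  cell : Σ Carrier G₁ → Σ Carrier G₂ → Fin v
  cell (a₁ , _) (a₂ , _) = pt a₁ a₂

  cell-surjective : (∀ p → ∃ λ g → g ▸ α ≡ p) → ∀ p → ∃₂ λ x y → cell x y ≡ p
  cell-surjective transitive p
    with g , gα≡p ← transitive p
    with g₁ , g₂ , g₁∈G₁ , g₂∈G₂ , g≈g₁g₂ ← generate {g} (lift tt) =
    (g₁ , g₁∈G₁) , (g₂ , g₂∈G₂) ,
    ≡.trans (≡.sym (act-∙ g₁ g₂ α)) (≡.trans (≡.sym (act-resp g≈g₁g₂ α)) gα≡p)

  origin₁ : Σ Carrier G₁
  origin₁ = ε , G₁.ε∈

  origin₂ : Σ Carrier G₂
  origin₂ = ε , G₂.ε∈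

  off-column : ∀ {u} (u∈G₁ : G₁ u) → ¬ L₁ u → ∀ y → cell (u , u∈G₁) origin₂ ≢ cell origin₁ y
  off-column u∈G₁ u∉L₁ (y , y∈G₂) u≡y =
    u∉L₁ (L₁.resp (ε\\x≈x _) (proj₁ (pt-≡⇒quotients∈L u∈G₁ G₂.ε∈ G₁.ε∈ y∈G₂ u≡y)))

  off-row : ∀ {u} (u∈G₂ : G₂ u) → ¬ L₂ u → ∀ x → cell origin₁ (u , u∈G₂) ≢ cell x origin₂
  off-row u∈G₂ u∉L₂ (x , x∈G₁) u≡x =
    u∉L₂ (L₂.resp (ε\\x≈x _) (proj₂ (pt-≡⇒quotients∈L G₁.ε∈ u∈G₂ x∈G₁ G₂.ε∈ u≡x)))

module BlockRectangles {c ℓ : Level} (G : Group c ℓ) {v b : ℕ} {inc : Fin v → Fin b → Bool}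
         {actP : Group.Carrier G → Fin v → Fin v} {actB : Group.Carrier G → Fin b → Fin b}
         (aut : IsAutGroup G inc actP actB) (ft : FlagTransitive G inc actP actB)
         {α : Fin v} {β : Fin b} (α∈β : inc α β ≡ true)
         {G₁ G₂ L₁ L₂ K₁ K₂ : Group.Carrier G → Set (c ⊔ ℓ)}
         (W : IsInternalDirectProduct G (Whole G) G₁ G₂)
         (S : IsInternalDirectProduct G (StabP G actP α) L₁ L₂)
         (L₁⊆G₁ : _⊆_ G L₁ G₁) (L₂⊆G₂ : _⊆_ G L₂ G₂)
         (K₁-subgroup : IsSubgroup G K₁) (K₁⊆G₁ : _⊆_ G K₁ G₁) (K₂⊆G₂ : _⊆_ G K₂ G₂)
         (K⊆Gβ : _⊆_ G (Prod G K₁ K₂) (StabB G actB β))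
         (K-transitive : TransitiveOnBlock G inc actP (Prod G K₁ K₂) β) where
  open Group G using (_∙_; _⁻¹; ε; identityˡ; sym)
  open IsAutGroup aut
  open IsAction actionP
  open OrbitGrid G actionP α W S L₁⊆G₁ L₂⊆G₂
  open ≡-Reasoning

  on-β⇒column-on-β : ∀ {p} → inc p β ≡ true →
                     ∃₂ λ k₁ k₂ → G₁ k₁ × G₂ k₂ × pt k₁ k₂ ≡ p × inc (pt ε k₂) β ≡ true
  on-β⇒column-on-β {p} p∈β
    with k , (k₁ , k₂ , k₁∈K₁ , k₂∈K₂ , k≈k₁k₂) , kα≡p ← K-transitive α _ α∈β p∈β =
    k₁ , k₂ , K₁⊆G₁ k₁∈K₁ , K₂⊆G₂ k₂∈K₂ , pt≡p , column-on-β
    where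
      pt≡p : pt k₁ k₂ ≡ p
      pt≡p = ≡.trans (≡.sym (act-∙ k₁ k₂ α)) (≡.trans (≡.sym (act-resp k≈k₁k₂ α)) kα≡p)

      k₂-fixes-β : actB k₂ β ≡ β
      k₂-fixes-β = lower (K⊆Gβ (ε , k₂ , IsSubgroup.ε∈ K₁-subgroup , k₂∈K₂ , sym (identityˡ k₂)))

      column-on-β : inc (pt ε k₂) β ≡ true
      column-on-β = ≡.subst₂ (λ q C → inc q C ≡ true) (≡.sym (act-ε _)) k₂-fixes-β
                             (preserve k₂ α β α∈β)

  block-rectangular : ∀ C {a₁ a₂ b₁ b₂} → G₁ a₁ → G₂ a₂ → G₁ b₁ → G₂ b₂ →
                      inc (pt a₁ a₂) C ≡ true → inc (pt b₁ b₂) C ≡ true → inc (pt a₁ b₂) C ≡ true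
  block-rectangular C {a₁} {a₂} {b₁} {b₂} a₁∈G₁ a₂∈G₂ b₁∈G₁ b₂∈G₂ a∈C b∈C
    with g , gα≡a , gβ≡C ← ft α β _ C α∈β a∈C
    with h₁ , h₂ , h₁∈G₁ , h₂∈G₂ , g≈h₁h₂ ← IsInternalDirectProduct.generate W {g} (lift tt)
    with k₁ , k₂ , k₁∈G₁ , k₂∈G₂ , k≡g⁻¹b , column-on-β
           ← on-β⇒column-on-β (incident-pullback G aut g
                                  (subst (λ C′ → inc (pt b₁ b₂) C′ ≡ true) (≡.sym gβ≡C) b∈C)) =
    subst (λ p → inc p C ≡ true) (≡.sym a₁b₂≡column) column-on-C
    where
      translate : ∀ {k₁} → G₁ k₁ → ∀ k₂ → g ▸ pt k₁ k₂ ≡ pt (h₁ ∙ k₁) (h₂ ∙ k₂)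
      translate k₁∈G₁ k₂ = ≡.trans (act-resp g≈h₁h₂ _) (pt-translate h₂∈G₂ k₁∈G₁ h₁ k₂)

      a-coordinates : pt a₁ a₂ ≡ pt (h₁ ∙ ε) (h₂ ∙ ε)
      a-coordinates = begin
        pt a₁ a₂     ≡⟨ gα≡a ⟨
        g ▸ α        ≡⟨ cong (g ▸_) pt-ε-ε ⟨
        g ▸ pt ε ε   ≡⟨ translate G₁.ε∈ ε ⟩
        pt (h₁ ∙ ε) (h₂ ∙ ε) ∎

      b-coordinates : pt b₁ b₂ ≡ pt (h₁ ∙ k₁) (h₂ ∙ k₂)
      b-coordinates = begin
        pt b₁ b₂               ≡⟨ act-inverseʳ G actionP g _ ⟨
        g ▸ g ⁻¹ ▸ pt b₁ b₂    ≡⟨ cong (g ▸_) k≡g⁻¹b ⟨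
        g ▸ pt k₁ k₂           ≡⟨ translate k₁∈G₁ k₂ ⟩
        pt (h₁ ∙ k₁) (h₂ ∙ k₂) ∎

      a₁b₂≡column : pt a₁ b₂ ≡ pt (h₁ ∙ ε) (h₂ ∙ k₂)
      a₁b₂≡column = coordinates-≡⇒pt-≡ a₁∈G₁ (G₁.∙∈ h₁∈G₁ G₁.ε∈) (G₂.∙∈ h₂∈G₂ k₂∈G₂)
        (proj₁ (pt-≡⇒coordinates-≡ a₁∈G₁ a₂∈G₂ (G₁.∙∈ h₁∈G₁ G₁.ε∈) (G₂.∙∈ h₂∈G₂ G₂.ε∈)
                                   a-coordinates))
        (proj₂ (pt-≡⇒coordinates-≡ b₁∈G₁ b₂∈G₂ (G₁.∙∈ h₁∈G₁ k₁∈G₁) (G₂.∙∈ h₂∈G₂ k₂∈G₂)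
                                   b-coordinates))

      column-on-C : inc (pt (h₁ ∙ ε) (h₂ ∙ k₂)) C ≡ true
      column-on-C = ≡.subst₂ (λ p C → inc p C ≡ true) (translate G₁.ε∈ k₂) gβ≡C
                             (preserve g _ β column-on-β)

  cell-rectangular : Rectangular inc cell
  cell-rectangular C {a₁ , a₁∈G₁} {a₂ , a₂∈G₂} {b₁ , b₁∈G₁} {b₂ , b₂∈G₂} =
    block-rectangular C a₁∈G₁ a₂∈G₂ b₁∈G₁ b₂∈G₂

lemma3p4 : ∀ {c ℓ : Level} (G : Group c ℓ)
    (v b k lam : ℕ) (inc : Fin v → Fin b → Bool) → Is2Design v b k lam inc →
    (actP : Group.Carrier G → Fin v → Fin v)
    (actB : Group.Carrier G → Fin b → Fin b) →
    IsAutGroup G inc actP actB → FlagTransitive G inc actP actB →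
    (α : Fin v) (β : Fin b) → inc α β ≡ true →
    (G₁ G₂ L₁ L₂ K₁ K₂ : Group.Carrier G → Set (c ⊔ ℓ)) →
    IsInternalDirectProduct G (Whole G) G₁ G₂ →
    IsInternalDirectProduct G (StabP G actP α) L₁ L₂ →
    _⊂_ G L₁ G₁ → _⊂_ G L₂ G₂ →
    IsSubgroup G K₁ → IsSubgroup G K₂ →
    _⊆_ G K₁ G₁ → _⊆_ G K₂ G₂ →
    _⊆_ G (Prod G K₁ K₂) (StabB G actB β) →
    ¬ TransitiveOnBlock G inc actP (Prod G K₁ K₂) β
lemma3p4 G v b k lam inc D actP actB aut ft α β α∈β G₁ G₂ L₁ L₂ K₁ K₂ W S
         (L₁⊆G₁ , u₁ , u₁∈G₁ , u₁∉L₁) (L₂⊆G₂ , u₂ , u₂∈G₂ , u₂∉L₂) K₁-subgroup _ K₁⊆G₁ K₂⊆G₂ K⊆Gβ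
         K-transitive =
  grid-not-rectangular D cell
    (cell-surjective (flagTransitive⇒pointTransitive G D actionP ft α∈β))
    origin₁ (u₁ , u₁∈G₁) origin₂ (u₂ , u₂∈G₂)
    (off-column u₁∈G₁ u₁∉L₁) (off-row u₂∈G₂ u₂∉L₂)
    cell-rectangular
  where
    open IsAutGroup aut using (actionP)
    open BlockRectangles G aut ft α∈β W S L₁⊆G₁ L₂⊆G₂ K₁-subgroup K₁⊆G₁ K₂⊆G₂ K⊆Gβ K-transitive
    open OrbitGrid G actionP α W S L₁⊆G₁ L₂⊆G₂
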